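{- Let $A,O,E$ be non-empty sets and $\phi\subseteq A\times O\times E$. For $X\subseteq A$, $Y\subseteq O$ define $\langle\phi\rangle_E(X,Y)=\{e\in E:(X\times Y\times\{e\})\cap\phi\neq\emptyset\}$, $[[\phi]]_E(X,Y)=\{e\in E:X\times Y\times\{e\}\subseteq\phi\}$, $[\phi]_E(X,Y)=E\setminus\langle\phi\rangle_E(A\setminus X,O\setminus Y)$, and $[\![\phi]\!]^{u}_E(X,Y)=[\phi]_E(X,Y)\cap[[\phi]]_E(A\setminus X,O\setminus Y)$. Then: (1) for all $X\subseteq A$, $Y\subseteq O$, if $X=A$ or $Y=O$, then $[\![\phi]\!]^{u}_E(X,Y)=E$; (2) for every $Y\subseteq O$, $[\![\phi]\!]^{u}_E(\emptyset,Y)=E$ if $Y=O$ and $=\emptyset$ otherwise; and for every $X\subseteq A$, $[\![\phi]\!]^{u}_E(X,\emptyset)=E$ if $X=A$ and $=\emptyset$ otherwise.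
   Context: $\langle\phi\rangle_E$ is a possibility operator, $[[\phi]]_E$ a sufficiency operator, $[\phi]_E$ the dual necessity operator, and $[\![\phi]\!]^{u}_E$ is the combined operator as defined in the claim. -}

module Defs where

open import Level using (0ℓ)
open import Data.Product using (Σ; ∃; _×_; _,_)
open import Relation.Unary using (Pred; ∁; _∩_; _∈_)

Rel3 : Set → Set → Set → Set₁
Rel3 A O E = Pred (A × O × E) 0ℓ

module _ {A O E : Set} (φ : Rel3 A O E) where

  poss : Pred A 0ℓ → Pred O 0ℓ → Pred E 0ℓ
  poss X Y e = Σ A λ a → Σ O λ o → a ∈ X × o ∈ Y × (a , o , e) ∈ φ

  suff : Pred A 0ℓ → Pred O 0ℓ → Pred E 0ℓ
  suff X Y e = ∀ a o → a ∈ X → o ∈ Y → (a , o , e) ∈ φ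

  nec : Pred A 0ℓ → Pred O 0ℓ → Pred E 0ℓ
  nec X Y = ∁ (poss (∁ X) (∁ Y))

  comb : Pred A 0ℓ → Pred O 0ℓ → Pred E 0ℓ
  comb X Y = nec X Y ∩ suff (∁ X) (∁ Y)

-- Both conjuncts of [[φ]]^u_E(X,Y) concern the rectangle (A∖X) × (O∖Y): at e, [φ]_E
-- says φ misses it and [[φ]]_E(A∖X,O∖Y) says φ contains it.  So e lies in
-- [[φ]]^u_E(X,Y) exactly when that rectangle is empty.  It is empty when X = A or
-- Y = O; and when A∖X is inhabited (e.g. X = ∅), it is empty only if O∖Y is, which
-- classically means Y = O.
module Submission where

open import Defs
open import Level using (0ℓ)
open import Data.Product using (_×_; _,_)
open import Data.Sum using (_⊎_; [_,_])
open import Data.Unit using (tt)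
open import Data.Empty using (⊥; ⊥-elim)
open import Relation.Nullary using (¬_)
open import Relation.Unary using (Pred; U; ∅; _≐_; _∈_; _∉_)
open import Axiom.ExcludedMiddle using (ExcludedMiddle)
open import Axiom.DoubleNegationElimination using (DoubleNegationElimination; em⇒dne)

module _ {A O E : Set} (φ : Rel3 A O E) {X : Pred A 0ℓ} {Y : Pred O 0ℓ} where

  comb-universalˡ : X ≐ U → comb φ X Y ≐ U
  comb-universalˡ (_ , U⊆X) =
    (λ _ → tt) ,
    λ _ → (λ { (_ , _ , a∉X , _) → a∉X (U⊆X tt) }) ,
          λ _ _ a∉X _ → ⊥-elim (a∉X (U⊆X tt))

  comb-universalʳ : Y ≐ U → comb φ X Y ≐ U
  comb-universalʳ (_ , U⊆Y) =
    (λ _ → tt) ,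
    λ _ → (λ { (_ , _ , _ , o∉Y , _) → o∉Y (U⊆Y tt) }) ,
          λ _ _ _ o∉Y → ⊥-elim (o∉Y (U⊆Y tt))

  comb-∁-disjoint : ∀ {a o e} → e ∈ comb φ X Y → a ∉ X → o ∉ Y → ⊥
  comb-∁-disjoint (nec , suff) a∉X o∉Y = nec (_ , _ , a∉X , o∉Y , suff _ _ a∉X o∉Y)

  comb-emptyʳ : DoubleNegationElimination 0ℓ → ∀ {a} → a ∉ X → ¬ (Y ≐ U) → comb φ X Y ≐ ∅
  comb-emptyʳ dne a∉X Y≉U =
    (λ e∈comb → Y≉U ((λ _ → tt) , λ _ → dne (comb-∁-disjoint e∈comb a∉X))) , λ ()

  comb-emptyˡ : DoubleNegationElimination 0ℓ → ∀ {o} → o ∉ Y → ¬ (X ≐ U) → comb φ X Y ≐ ∅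
  comb-emptyˡ dne o∉Y X≉U =
    (λ e∈comb → X≉U ((λ _ → tt) , λ _ → dne (λ a∉X → comb-∁-disjoint e∈comb a∉X o∉Y))) , λ ()

mainTheorem2 : ExcludedMiddle 0ℓ →
    {A O E : Set} → A → O → E → (φ : Rel3 A O E) →
    ((X : Pred A 0ℓ) (Y : Pred O 0ℓ) → (X ≐ U) ⊎ (Y ≐ U) → comb φ X Y ≐ U)
    × ((Y : Pred O 0ℓ) →
    ((Y ≐ U) → comb φ ∅ Y ≐ U) × (¬ (Y ≐ U) → comb φ ∅ Y ≐ ∅))
    × ((X : Pred A 0ℓ) →
    ((X ≐ U) → comb φ X ∅ ≐ U) × (¬ (X ≐ U) → comb φ X ∅ ≐ ∅))
mainTheorem2 em a o _ φ =
  (λ X Y → [ comb-universalˡ φ , comb-universalʳ φ ]) ,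
  (λ Y → comb-universalʳ φ , comb-emptyʳ φ dne {a} λ ()) ,
  (λ X → comb-universalˡ φ , comb-emptyˡ φ dne {o} λ ())
  where
  dne : DoubleNegationElimination 0ℓ
  dne = em⇒dne em
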